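{- Let $F$ be a field of characteristic zero, $\{a_\ell\}_{\ell=1}^\infty\subset F^*$ a sequence of pairwise distinct nonzero elements, and $2\le r<n$ integers. Let $C$ be the $(n-r)\times(r+1)$ matrix defined below. Then for every $m\le\min\{r+1,n-r\}$, every $m\times m$ submatrix of $C$ has nonzero determinant; consequently $C$ has rank $\min\{n-r,r+1\}$.
   Context: For indices $\ell,e$ put $d_{(\ell,e)}:=a_\ell-a_e$. Let $I=\{1,\dots,r\}$ and $I_j=I\setminus\{j\}$ for $j\in I$. Let $C=[C_{(i-r,j)}]$ have rows indexed by $i=r+1,\dots,n$ and columns by $j=0,\dots,r$, with $$C_{(i-r,0)}=(-1)^r\prod_{\ell\in I} d_{(i,\ell)}\cdot\prod_{e<\ell,\ e,\ell\in I} d_{(\ell,e)},\qquad C_{(i-r,j)}=(-1)^{r+j}\,a_i\prod_{\ell\in I_j} d_{(i,\ell)}\cdot\prod_{e<\ell,\ e,\ell\in I_j} a_\ell\, d_{(\ell,e)}\quad (1\le j\le r).$$ -}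

module Defs where

open import Level using (_⊔_) renaming (suc to lsuc)
open import Algebra.Bundles using (CommutativeRing; Semiring)
open import Data.Nat as ℕ using (ℕ; zero; suc; _∸_; _≟_; _<?_)
open import Data.Fin using (Fin; toℕ; punchIn) renaming (zero to fzero; suc to fsuc; _<_ to _<ᶠ_)
open import Data.List using (List; filter; upTo; map; foldr)
open import Data.Product using (Σ; ∃; _×_)
open import Relation.Nullary using (¬_)
open import Relation.Nullary.Decidable using (¬?)

record Field c ℓ : Set (lsuc (c ⊔ ℓ)) where
  field
    commutativeRing : CommutativeRing c ℓ
  open CommutativeRing commutativeRing public
  field
    1≉0     : ¬ (1# ≈ 0#)
    inverse : ∀ x → ¬ (x ≈ 0#) → Σ Carrier λ y → (x * y) ≈ 1#

module FieldDefs {c ℓ} (F : Field c ℓ) where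
  open Field F
  open import Algebra.Definitions.RawSemiring (Semiring.rawSemiring semiring) using (sum) renaming (_×_ to _·_)

  CharZero : Set ℓ
  CharZero = ∀ k → ¬ ((suc k · 1#) ≈ 0#)

  ∏ : List ℕ → (ℕ → Carrier) → Carrier
  ∏ xs f = foldr (λ x acc → f x * acc) 1# xs

  sgn : ℕ → Carrier
  sgn zero    = 1#
  sgn (suc k) = - sgn k

  det : ∀ {m} → (Fin m → Fin m → Carrier) → Carrier
  det {zero}  M = 1#
  det {suc m} M = sum λ j → (sgn (toℕ j) * M fzero j) * det (λ p q → M (fsuc p) (punchIn j q))

  I : ℕ → List ℕ
  I r = map suc (upTo r)

  I∖ : ℕ → ℕ → List ℕ
  I∖ r j = filter (λ l → ¬? (l ≟ j)) (I r)

  d : (ℕ → Carrier) → ℕ → ℕ → Carrier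
  d a l e = a l - a e

  ∏pairs : List ℕ → (ℕ → ℕ → Carrier) → Carrier
  ∏pairs S g = ∏ S (λ l → ∏ (filter (λ e → e <? l) S) (λ e → g l e))

  -- The (n−r)×(r+1) matrix C: row p ↔ i = r+1+p (i = r+1,…,n), column j ∈ {0,…,r}.
  C : (ℕ → Carrier) → (n r : ℕ) → Fin (n ∸ r) → Fin (suc r) → Carrier
  C a n r p fzero =
    (sgn r * ∏ (I r) (λ l → d a (suc r ℕ.+ toℕ p) l)) * ∏pairs (I r) (d a)
  C a n r p (fsuc j′) =
    let i = suc r ℕ.+ toℕ p
        j = suc (toℕ j′)
    in ((sgn (r ℕ.+ j) * a i) * ∏ (I∖ r j) (λ l → d a i l))
       * ∏pairs (I∖ r j) (λ l e → a l * d a l e)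

  StrictInc : ∀ {m k} → (Fin m → Fin k) → Set
  StrictInc f = ∀ i j → i <ᶠ j → f i <ᶠ f j

  minor : ∀ {p q m} → (Fin p → Fin q → Carrier) → (Fin m → Fin p) → (Fin m → Fin q) → Carrier
  minor M f g = det (λ s t → M (f s) (g t))

  HasRank : ∀ {p q} → (Fin p → Fin q → Carrier) → ℕ → Set ℓ
  HasRank {p} {q} M k =
    (Σ (Fin k → Fin p) λ f → Σ (Fin k → Fin q) λ g →
        StrictInc f × StrictInc g × ¬ (minor M f g ≈ 0#))
    × (∀ (f : Fin (suc k) → Fin p) (g : Fin (suc k) → Fin q) →
        StrictInc f → StrictInc g → minor M f g ≈ 0#)

module Submission where

-- Idea.  Put x_p = a_{r+1+p} for the rows, y_0 = 0 and y_j = a_j for the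
-- columns.  Every entry factors as  C_{pj} · (x_p − y_j) = R_p · K_j  with
-- R_p, K_j nonzero (a_i − a_j times the product over I_j is the product over I),
-- so C is a Cauchy matrix 1/(x_p − y_j) rescaled by nonzero row and column
-- factors, and its nodes are pairwise distinct.  Submatrices of such matrices
-- are of the same kind, and they are nonsingular: one step of Gaussian
-- elimination at the top-left pivot leaves a Schur complement that is again a
-- rescaled Cauchy matrix, one size smaller.

open import Defs
open import Level using (_⊔_)
open import Algebra.Bundles using (CommutativeRing)
open import Data.Nat as ℕ using (ℕ; zero; suc; _≤_; _<_; _∸_; _⊓_)
import Data.Nat.Properties as ℕP
open import Data.Integer as ℤ using (ℤ; +_; -[1+_]; _◃_; sign; ∣_∣)
import Data.Integer.Properties as ℤP
import Data.Sign as Sign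
open import Data.Maybe using (Maybe; just; nothing)
open import Data.Fin as Fin using (Fin; toℕ; punchIn; punchOut) renaming (zero to fzero; suc to fsuc)
import Data.Fin.Properties as FinP
open import Data.List using (List; []; _∷_; filter)
import Data.List.Properties as ListP
open import Data.List.Relation.Unary.All as All using (All; []; _∷_)
import Data.List.Relation.Unary.All.Properties as AllP
open import Data.Product using (_×_; _,_; proj₁; proj₂)
open import Data.Empty using (⊥-elim)
open import Function using (_∘_)
open import Function.Definitions using (Injective)
open import Relation.Binary.Definitions using (tri<; tri≈; tri>)
open import Relation.Nullary using (¬_; yes; no)
open import Relation.Nullary.Decidable using (¬?)
open import Relation.Binary.PropositionalEquality as ≡ using (_≡_; _≢_)

-- The ring solver of the library is parametrised by a coefficient ring mapping
-- into the target ring.  Integer coefficients make it complete for identities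
-- of commutative rings that need cancellation (x − x = 0); this module builds
-- the canonical map ℤ → R and instantiates the solver with it.
module IntegerCoefficientSolver {c ℓ} (CR : CommutativeRing c ℓ) where
  open CommutativeRing CR
  open import Algebra.Properties.Semiring.Mult semiring using (×-homo-+; ×1-homo-*) renaming (_×_ to _·_)
  open import Algebra.Properties.Ring ring using (-‿distribˡ-*; -‿distribʳ-*; -‿involutive; -0#≈0#)
  open import Algebra.Properties.AbelianGroup +-abelianGroup using (⁻¹-∙-comm)
  open import Relation.Binary.Reasoning.Setoid setoid
  open import Algebra.Solver.Ring.AlmostCommutativeRing using (fromCommutativeRing; _-Raw-AlmostCommutative⟶_)

  ⟦_⟧ⁿ : ℕ → Carrier
  ⟦ n ⟧ⁿ = n · 1#

  ⟦_⟧ᶻ : ℤ → Carrier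
  ⟦ + n ⟧ᶻ      = ⟦ n ⟧ⁿ
  ⟦ -[1+ n ] ⟧ᶻ = - ⟦ suc n ⟧ⁿ

  ⟦_⟧ˢ : Sign.Sign → Carrier
  ⟦ Sign.+ ⟧ˢ = 1#
  ⟦ Sign.- ⟧ˢ = - 1#

  shift-sub : ∀ a b → (1# + a) - (1# + b) ≈ a - b
  shift-sub a b = begin
    (1# + a) + - (1# + b)   ≈⟨ +-congˡ (sym (⁻¹-∙-comm 1# b)) ⟩
    (1# + a) + (- 1# + - b) ≈⟨ +-assoc 1# a _ ⟩
    1# + (a + (- 1# + - b)) ≈⟨ +-congˡ (sym (+-assoc a (- 1#) (- b))) ⟩
    1# + ((a + - 1#) + - b) ≈⟨ +-congˡ (+-congʳ (+-comm a (- 1#))) ⟩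
    1# + ((- 1# + a) + - b) ≈⟨ +-congˡ (+-assoc (- 1#) a (- b)) ⟩
    1# + (- 1# + (a + - b)) ≈⟨ sym (+-assoc 1# (- 1#) _) ⟩
    (1# + - 1#) + (a + - b) ≈⟨ +-congʳ (-‿inverseʳ 1#) ⟩
    0# + (a + - b)          ≈⟨ +-identityˡ _ ⟩
    a - b                   ∎

  sub-zero : ∀ x → x - 0# ≈ x
  sub-zero x = trans (+-congˡ -0#≈0#) (+-identityʳ x)

  ⊖-homo : ∀ m n → ⟦ m ℤ.⊖ n ⟧ᶻ ≈ ⟦ m ⟧ⁿ - ⟦ n ⟧ⁿ
  ⊖-homo zero    zero    = sym (sub-zero 0#)
  ⊖-homo (suc m) zero    = sym (sub-zero _)
  ⊖-homo zero    (suc n) = sym (+-identityˡ _)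
  ⊖-homo (suc m) (suc n) rewrite ℤP.[1+m]⊖[1+n]≡m⊖n m n =
    trans (⊖-homo m n) (sym (shift-sub ⟦ m ⟧ⁿ ⟦ n ⟧ⁿ))

  +-homo : ∀ i j → ⟦ i ℤ.+ j ⟧ᶻ ≈ ⟦ i ⟧ᶻ + ⟦ j ⟧ᶻ
  +-homo (+ m)    (+ n)    = ×-homo-+ 1# m n
  +-homo (+ m)    -[1+ n ] = ⊖-homo m (suc n)
  +-homo -[1+ m ] (+ n)    = trans (⊖-homo n (suc m)) (+-comm _ _)
  +-homo -[1+ m ] -[1+ n ] = begin
    - ⟦ suc (suc (m ℕ.+ n)) ⟧ⁿ     ≡⟨ ≡.cong (λ k → - ⟦ suc k ⟧ⁿ) (≡.sym (ℕP.+-suc m n)) ⟩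
    - ⟦ suc m ℕ.+ suc n ⟧ⁿ         ≈⟨ -‿cong (×-homo-+ 1# (suc m) (suc n)) ⟩
    - (⟦ suc m ⟧ⁿ + ⟦ suc n ⟧ⁿ)    ≈⟨ sym (⁻¹-∙-comm _ _) ⟩
    - ⟦ suc m ⟧ⁿ + - ⟦ suc n ⟧ⁿ    ∎

  ◃-homo : ∀ s n → ⟦ s ◃ n ⟧ᶻ ≈ ⟦ s ⟧ˢ * ⟦ n ⟧ⁿ
  ◃-homo Sign.+ zero    = sym (zeroʳ _)
  ◃-homo Sign.- zero    = sym (zeroʳ _)
  ◃-homo Sign.+ (suc n) = sym (*-identityˡ _)
  ◃-homo Sign.- (suc n) = trans (-‿cong (sym (*-identityˡ _))) (-‿distribˡ-* 1# _)

  sign-abs : ∀ i → ⟦ i ⟧ᶻ ≈ ⟦ sign i ⟧ˢ * ⟦ ∣ i ∣ ⟧ⁿ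
  sign-abs i = trans (reflexive (≡.cong ⟦_⟧ᶻ (≡.sym (ℤP.◃-inverse i)))) (◃-homo (sign i) ∣ i ∣)

  sign-homo : ∀ s t → ⟦ s Sign.* t ⟧ˢ ≈ ⟦ s ⟧ˢ * ⟦ t ⟧ˢ
  sign-homo Sign.+ Sign.+ = sym (*-identityˡ _)
  sign-homo Sign.+ Sign.- = sym (*-identityˡ _)
  sign-homo Sign.- Sign.+ = sym (*-identityʳ _)
  sign-homo Sign.- Sign.- = begin
    1#            ≈⟨ sym (-‿involutive 1#) ⟩
    - - 1#        ≈⟨ -‿cong (sym (*-identityʳ _)) ⟩
    - (- 1# * 1#) ≈⟨ -‿distribʳ-* _ _ ⟩
    - 1# * - 1#   ∎

  interchange : ∀ a b c d → (a * b) * (c * d) ≈ (a * c) * (b * d)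
  interchange a b c d = begin
    (a * b) * (c * d) ≈⟨ *-assoc a b _ ⟩
    a * (b * (c * d)) ≈⟨ *-congˡ (sym (*-assoc b c d)) ⟩
    a * ((b * c) * d) ≈⟨ *-congˡ (*-congʳ (*-comm b c)) ⟩
    a * ((c * b) * d) ≈⟨ *-congˡ (*-assoc c b d) ⟩
    a * (c * (b * d)) ≈⟨ sym (*-assoc a c _) ⟩
    (a * c) * (b * d) ∎

  *-homo : ∀ i j → ⟦ i ℤ.* j ⟧ᶻ ≈ ⟦ i ⟧ᶻ * ⟦ j ⟧ᶻ
  *-homo i j = begin
    ⟦ (sign i Sign.* sign j) ◃ (∣ i ∣ ℕ.* ∣ j ∣) ⟧ᶻ
      ≈⟨ ◃-homo (sign i Sign.* sign j) (∣ i ∣ ℕ.* ∣ j ∣) ⟩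
    ⟦ sign i Sign.* sign j ⟧ˢ * ⟦ ∣ i ∣ ℕ.* ∣ j ∣ ⟧ⁿ
      ≈⟨ *-cong (sign-homo (sign i) (sign j)) (×1-homo-* ∣ i ∣ ∣ j ∣) ⟩
    (⟦ sign i ⟧ˢ * ⟦ sign j ⟧ˢ) * (⟦ ∣ i ∣ ⟧ⁿ * ⟦ ∣ j ∣ ⟧ⁿ)
      ≈⟨ interchange _ _ _ _ ⟩
    (⟦ sign i ⟧ˢ * ⟦ ∣ i ∣ ⟧ⁿ) * (⟦ sign j ⟧ˢ * ⟦ ∣ j ∣ ⟧ⁿ)
      ≈⟨ sym (*-cong (sign-abs i) (sign-abs j)) ⟩
    ⟦ i ⟧ᶻ * ⟦ j ⟧ᶻ ∎

  neg-homo : ∀ i → ⟦ ℤ.- i ⟧ᶻ ≈ - ⟦ i ⟧ᶻ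
  neg-homo (+ zero)   = sym -0#≈0#
  neg-homo (+ suc n)  = refl
  neg-homo -[1+ n ]   = sym (-‿involutive _)

  ℤ-homomorphism : ℤ.+-*-rawRing -Raw-AlmostCommutative⟶ fromCommutativeRing CR
  ℤ-homomorphism = record
    { ⟦_⟧ = ⟦_⟧ᶻ ; +-homo = +-homo ; *-homo = *-homo ; -‿homo = neg-homo
    ; 0-homo = refl ; 1-homo = +-identityʳ 1# }

  coefficient-equality : ∀ i j → Maybe (⟦ i ⟧ᶻ ≈ ⟦ j ⟧ᶻ)
  coefficient-equality i j with i ℤ.≟ j
  ... | yes ≡.refl = just refl
  ... | no _       = nothing

  open import Algebra.Solver.Ring ℤ.+-*-rawRing (fromCommutativeRing CR) ℤ-homomorphism coefficient-equality public

module FieldArithmetic {c ℓ} (F : Field c ℓ) where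
  open Field F
  open FieldDefs F using (sgn; CharZero)
  open import Algebra.Properties.Ring ring using (-‿involutive; -0#≈0#)
  open import Algebra.Properties.AbelianGroup +-abelianGroup using (x∙y⁻¹≈ε⇒x≈y)
  open import Relation.Binary.Reasoning.Setoid setoid

  cancelˡ : ∀ a x → ¬ (a ≈ 0#) → a * x ≈ 0# → x ≈ 0#
  cancelˡ a x a≉0 ax≈0 = begin
    x            ≈⟨ sym (*-identityˡ x) ⟩
    1# * x       ≈⟨ *-congʳ (sym (trans (*-comm a⁻¹ a) (proj₂ (inverse a a≉0)))) ⟩
    (a⁻¹ * a) * x ≈⟨ *-assoc a⁻¹ a x ⟩
    a⁻¹ * (a * x) ≈⟨ *-congˡ ax≈0 ⟩
    a⁻¹ * 0#     ≈⟨ zeroʳ a⁻¹ ⟩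
    0#           ∎
    where a⁻¹ = proj₁ (inverse a a≉0)

  *-nonzero : ∀ a b → ¬ (a ≈ 0#) → ¬ (b ≈ 0#) → ¬ (a * b ≈ 0#)
  *-nonzero a b a≉0 b≉0 ab≈0 = b≉0 (cancelˡ a b a≉0 ab≈0)

  -≈0⇒≈0 : ∀ a → - a ≈ 0# → a ≈ 0#
  -≈0⇒≈0 a -a≈0 = trans (sym (-‿involutive a)) (trans (-‿cong -a≈0) -0#≈0#)

  sub-nonzero : ∀ a b → ¬ (a ≈ b) → ¬ (a - b ≈ 0#)
  sub-nonzero a b a≉b a-b≈0 = a≉b (x∙y⁻¹≈ε⇒x≈y a b a-b≈0)

  sgn-nonzero : ∀ k → ¬ (sgn k ≈ 0#)
  sgn-nonzero zero    = 1≉0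
  sgn-nonzero (suc k) = sgn-nonzero k ∘ -≈0⇒≈0 (sgn k)

  -- 1 + 1 ≠ 0; this is all of characteristic zero that determinants need
  CharNotTwo : Set ℓ
  CharNotTwo = ¬ (1# + 1# ≈ 0#)

  charZero⇒charNotTwo : CharZero → CharNotTwo
  charZero⇒charNotTwo charZero 2≈0 = charZero 1 (trans (+-congˡ (+-identityʳ 1#)) 2≈0)

-- From the vanishing on a repeated row onwards they assume 2 ≠ 0, which is used
-- to pass from "det is antisymmetric" to "det is alternating".
module Determinant {c ℓ} (F : Field c ℓ) where
  open Field F
  open FieldDefs F using (det; sgn)
  open FieldArithmetic F
  open IntegerCoefficientSolver commutativeRing using (solve; _:+_; _:*_; :-_; _:=_; con)
  open import Algebra.Bundles using (Semiring)
  open import Algebra.Definitions.RawSemiring (Semiring.rawSemiring semiring) using (_^_)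
  open import Algebra.Properties.Semiring.Sum semiring
    using (sum; sum-cong-≋; sum-replicate-zero; sum-remove; ∑-comm; ∑-distrib-+; *-distribˡ-sum)
  open import Algebra.Properties.Ring ring using (-0#≈0#)
  open import Algebra.Properties.AbelianGroup +-abelianGroup using (⁻¹-∙-comm)
  open import Relation.Binary.Reasoning.Setoid setoid

  Mat : ℕ → Set c
  Mat m = Fin m → Fin m → Carrier

  colSign : ∀ {n} → Fin n → Carrier
  colSign j = sgn (toℕ j)

  ∑-cong : ∀ {n} {f g : Fin n → Carrier} → (∀ j → f j ≈ g j) → sum f ≈ sum g
  ∑-cong = sum-cong-≋

  ∑-zero : ∀ {n} (f : Fin n → Carrier) → (∀ j → f j ≈ 0#) → sum f ≈ 0#
  ∑-zero {n} f f≈0 = trans (∑-cong f≈0) (sum-replicate-zero n)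

  ∑-neg : ∀ {n} (f : Fin n → Carrier) → sum (λ j → - f j) ≈ - sum f
  ∑-neg {zero}  f = sym -0#≈0#
  ∑-neg {suc n} f = trans (+-congˡ (∑-neg (f ∘ fsuc))) (⁻¹-∙-comm (f fzero) (sum (f ∘ fsuc)))

  ∑-linear : ∀ {n} α β (f g : Fin n → Carrier) →
    sum (λ j → α * f j + β * g j) ≈ α * sum f + β * sum g
  ∑-linear α β f g = begin
    sum (λ j → α * f j + β * g j)             ≈⟨ ∑-distrib-+ (λ j → α * f j) (λ j → β * g j) ⟩
    sum (λ j → α * f j) + sum (λ j → β * g j) ≈⟨ sym (+-cong (*-distribˡ-sum α f) (*-distribˡ-sum β g)) ⟩
    α * sum f + β * sum g                     ∎

  minor₀ : ∀ {m} → Mat (suc m) → Fin (suc m) → Mat m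
  minor₀ M j p q = M (fsuc p) (punchIn j q)

  expansionTerm : ∀ {m} → Mat (suc m) → Fin (suc m) → Carrier
  expansionTerm M j = (colSign j * M fzero j) * det (minor₀ M j)

  det-cong : ∀ {m} (M N : Mat m) → (∀ s t → M s t ≈ N s t) → det M ≈ det N
  det-cong {zero}  M N M≈N = refl
  det-cong {suc m} M N M≈N = ∑-cong {f = expansionTerm M} {g = expansionTerm N} λ j →
    *-cong (*-congˡ (M≈N fzero j)) (det-cong (minor₀ M j) (minor₀ N j) (λ p q → M≈N (fsuc p) (punchIn j q)))

  det-linear : ∀ {m} (k : Fin m) α β (M N P : Mat m) →
    (∀ s → s ≢ k → ∀ t → P s t ≈ M s t) → (∀ s → s ≢ k → ∀ t → P s t ≈ N s t) →
    (∀ t → P k t ≈ α * M k t + β * N k t) → det P ≈ α * det M + β * det N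
  det-linear {suc m} k α β M N P = λ P≈M P≈N Pₖ → begin
    sum (expansionTerm P)                                     ≈⟨ ∑-cong {f = expansionTerm P} (termwise k P≈M P≈N Pₖ) ⟩
    sum (λ j → α * expansionTerm M j + β * expansionTerm N j) ≈⟨ ∑-linear α β (expansionTerm M) (expansionTerm N) ⟩
    α * det M + β * det N                                     ∎
    where
    termwise : ∀ k → (∀ s → s ≢ k → ∀ t → P s t ≈ M s t) → (∀ s → s ≢ k → ∀ t → P s t ≈ N s t) →
      (∀ t → P k t ≈ α * M k t + β * N k t) →
      ∀ j → expansionTerm P j ≈ α * expansionTerm M j + β * expansionTerm N j
    termwise fzero P≈M P≈N P₀ j = begin
      (colSign j * P fzero j) * det (minor₀ P j)
        ≈⟨ *-congʳ (*-congˡ (P₀ j)) ⟩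
      (colSign j * (α * M fzero j + β * N fzero j)) * det (minor₀ P j)
        ≈⟨ solve 6 (λ σ x y a b D → (σ :* ((a :* x) :+ (b :* y))) :* D
                                   := (a :* ((σ :* x) :* D)) :+ (b :* ((σ :* y) :* D)))
                 refl (colSign j) (M fzero j) (N fzero j) α β (det (minor₀ P j)) ⟩
      α * ((colSign j * M fzero j) * det (minor₀ P j)) + β * ((colSign j * N fzero j) * det (minor₀ P j))
        ≈⟨ +-cong (*-congˡ (*-congˡ (det-cong _ _ (λ p q → P≈M (fsuc p) (λ ()) (punchIn j q)))))
                  (*-congˡ (*-congˡ (det-cong _ _ (λ p q → P≈N (fsuc p) (λ ()) (punchIn j q))))) ⟩
      α * expansionTerm M j + β * expansionTerm N j ∎
    termwise (fsuc k) P≈M P≈N Pₖ j = begin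
      (colSign j * P fzero j) * det (minor₀ P j)
        ≈⟨ *-congˡ (det-linear k α β (minor₀ M j) (minor₀ N j) (minor₀ P j)
             (λ s s≢k t → P≈M (fsuc s) (s≢k ∘ FinP.suc-injective) (punchIn j t))
             (λ s s≢k t → P≈N (fsuc s) (s≢k ∘ FinP.suc-injective) (punchIn j t))
             (λ t → Pₖ (punchIn j t))) ⟩
      (colSign j * P fzero j) * (α * det (minor₀ M j) + β * det (minor₀ N j))
        ≈⟨ solve 5 (λ x a b D E → x :* ((a :* D) :+ (b :* E)) := (a :* (x :* D)) :+ (b :* (x :* E)))
                 refl (colSign j * P fzero j) α β (det (minor₀ M j)) (det (minor₀ N j)) ⟩
      α * ((colSign j * P fzero j) * det (minor₀ M j)) + β * ((colSign j * P fzero j) * det (minor₀ N j))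
        ≈⟨ +-cong (*-congˡ (*-congʳ (*-congˡ (P≈M fzero (λ ()) j))))
                  (*-congˡ (*-congʳ (*-congˡ (P≈N fzero (λ ()) j)))) ⟩
      α * expansionTerm M j + β * expansionTerm N j ∎

  -- Expanding along rows 0 and 1 at once writes det M as Σ_a Σ_b pairTerm M a b,
  -- the summand in which row 0 uses column a and row 1 uses column b ≠ a.
  doubleMinor : ∀ {m} → Mat (suc (suc m)) → Fin (suc (suc m)) → Fin (suc m) → Mat m
  doubleMinor M a k p q = M (fsuc (fsuc p)) (punchIn a (punchIn k q))

  pairTerm : ∀ {m} → Mat (suc (suc m)) → Fin (suc (suc m)) → Fin (suc (suc m)) → Carrier
  pairTerm M a b with a Fin.≟ b
  ... | yes _   = 0#
  ... | no a≢b  = (colSign a * M fzero a)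
                  * ((colSign (punchOut a≢b) * M (fsuc fzero) b) * det (doubleMinor M a (punchOut a≢b)))

  pairTerm-diagonal : ∀ {m} (M : Mat (suc (suc m))) a → pairTerm M a a ≈ 0#
  pairTerm-diagonal M a with a Fin.≟ a
  ... | yes _   = refl
  ... | no a≢a  = ⊥-elim (a≢a ≡.refl)

  pairTerm-punchIn : ∀ {m} (M : Mat (suc (suc m))) a k →
    (colSign a * M fzero a) * expansionTerm (minor₀ M a) k ≈ pairTerm M a (punchIn a k)
  pairTerm-punchIn M a k with a Fin.≟ punchIn a k
  ... | yes a≡ = ⊥-elim (FinP.punchInᵢ≢i a k (≡.sym a≡))
  ... | no a≢  = reflexive (≡.cong (λ k′ → (colSign a * M fzero a)
                   * ((colSign k′ * M (fsuc fzero) (punchIn a k)) * det (doubleMinor M a k′)))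
                   (≡.sym (≡.trans (FinP.punchOut-cong a {i≢j = a≢} {i≢k = FinP.punchInᵢ≢i a k ∘ ≡.sym} ≡.refl)
                                   (FinP.punchOut-punchIn a))))

  det-pairs : ∀ {m} (M : Mat (suc (suc m))) → det M ≈ sum (λ a → sum (λ b → pairTerm M a b))
  det-pairs M = ∑-cong {f = expansionTerm M} λ a → begin
    (colSign a * M fzero a) * sum (expansionTerm (minor₀ M a))
      ≈⟨ *-distribˡ-sum (colSign a * M fzero a) (expansionTerm (minor₀ M a)) ⟩
    sum (λ k → (colSign a * M fzero a) * expansionTerm (minor₀ M a) k)
      ≈⟨ ∑-cong {f = λ k → (colSign a * M fzero a) * expansionTerm (minor₀ M a) k} (pairTerm-punchIn M a) ⟩
    sum (λ k → pairTerm M a (punchIn a k))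
      ≈⟨ sym (+-identityˡ _) ⟩
    0# + sum (λ k → pairTerm M a (punchIn a k))
      ≈⟨ +-congʳ (sym (pairTerm-diagonal M a)) ⟩
    pairTerm M a a + sum (λ k → pairTerm M a (punchIn a k))
      ≈⟨ sym (sum-remove {i = a} (pairTerm M a)) ⟩
    sum (λ b → pairTerm M a b) ∎

  punchIn-punchOut-comm : ∀ {n} (a b : Fin (suc (suc n))) (a≢b : a ≢ b) (b≢a : b ≢ a) (q : Fin n) →
    punchIn a (punchIn (punchOut a≢b) q) ≡ punchIn b (punchIn (punchOut b≢a) q)
  punchIn-punchOut-comm fzero fzero a≢b b≢a q = ⊥-elim (a≢b ≡.refl)
  punchIn-punchOut-comm fzero (fsuc b) a≢b b≢a q = ≡.refl
  punchIn-punchOut-comm (fsuc a) fzero a≢b b≢a q = ≡.refl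
  punchIn-punchOut-comm {suc n} (fsuc a) (fsuc b) a≢b b≢a fzero = ≡.refl
  punchIn-punchOut-comm {suc n} (fsuc a) (fsuc b) a≢b b≢a (fsuc q) =
    ≡.cong fsuc (punchIn-punchOut-comm a b (a≢b ∘ ≡.cong fsuc) (b≢a ∘ ≡.cong fsuc) q)

  colSign-punchOut : ∀ {n} (a b : Fin (suc n)) (a≢b : a ≢ b) (b≢a : b ≢ a) →
    colSign a * colSign (punchOut a≢b) ≈ - (colSign b * colSign (punchOut b≢a))
  colSign-punchOut fzero fzero a≢b b≢a = ⊥-elim (a≢b ≡.refl)
  colSign-punchOut {suc n} fzero (fsuc b) a≢b b≢a =
    solve 2 (λ o x → o :* x := :- ((:- x) :* o)) refl 1# (colSign b)
  colSign-punchOut {suc n} (fsuc a) fzero a≢b b≢a =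
    solve 2 (λ o x → (:- x) :* o := :- (o :* x)) refl 1# (colSign a)
  colSign-punchOut {suc n} (fsuc a) (fsuc b) a≢b b≢a = begin
    (- colSign a) * (- colSign (punchOut a≢b′)) ≈⟨ neg-neg _ _ ⟩
    colSign a * colSign (punchOut a≢b′)         ≈⟨ colSign-punchOut a b a≢b′ b≢a′ ⟩
    - (colSign b * colSign (punchOut b≢a′))     ≈⟨ -‿cong (sym (neg-neg _ _)) ⟩
    - ((- colSign b) * (- colSign (punchOut b≢a′))) ∎
    where
    a≢b′ = a≢b ∘ ≡.cong fsuc
    b≢a′ = b≢a ∘ ≡.cong fsuc
    neg-neg : ∀ x y → (- x) * (- y) ≈ x * y
    neg-neg = solve 2 (λ x y → (:- x) :* (:- y) := x :* y) refl

  swap₀₁ : ∀ {m} → Fin (suc (suc m)) → Fin (suc (suc m))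
  swap₀₁ fzero           = fsuc fzero
  swap₀₁ (fsuc fzero)    = fzero
  swap₀₁ (fsuc (fsuc p)) = fsuc (fsuc p)

  pairTerm-swap₀₁ : ∀ {m} (M : Mat (suc (suc m))) a b → pairTerm (M ∘ swap₀₁) a b ≈ - pairTerm M b a
  pairTerm-swap₀₁ M a b with a Fin.≟ b | b Fin.≟ a
  ... | yes _   | yes _   = sym -0#≈0#
  ... | yes a≡b | no b≢a  = ⊥-elim (b≢a (≡.sym a≡b))
  ... | no a≢b  | yes b≡a = ⊥-elim (a≢b (≡.sym b≡a))
  ... | no a≢b  | no b≢a  = begin
    (colSign a * M₁ a) * ((colSign (punchOut a≢b) * M₀ b) * det (doubleMinor M a (punchOut a≢b)))
      ≈⟨ solve 5 (λ σ τ x y D → (σ :* x) :* ((τ :* y) :* D) := (σ :* τ) :* (x :* (y :* D)))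
               refl (colSign a) (colSign (punchOut a≢b)) (M₁ a) (M₀ b) _ ⟩
    (colSign a * colSign (punchOut a≢b)) * (M₁ a * (M₀ b * det (doubleMinor M a (punchOut a≢b))))
      ≈⟨ *-cong (colSign-punchOut a b a≢b b≢a)
                (*-congˡ (*-congˡ (det-cong _ _ λ p q →
                   reflexive (≡.cong (M (fsuc (fsuc p))) (punchIn-punchOut-comm a b a≢b b≢a q))))) ⟩
    (- (colSign b * colSign (punchOut b≢a))) * (M₁ a * (M₀ b * det (doubleMinor M b (punchOut b≢a))))
      ≈⟨ solve 5 (λ σ τ x y D → (:- (σ :* τ)) :* (x :* (y :* D)) := :- ((σ :* y) :* ((τ :* x) :* D)))
               refl (colSign b) (colSign (punchOut b≢a)) (M₁ a) (M₀ b) _ ⟩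
    - ((colSign b * M₀ b) * ((colSign (punchOut b≢a) * M₁ a) * det (doubleMinor M b (punchOut b≢a)))) ∎
    where
    M₀ = M fzero
    M₁ = M (fsuc fzero)

  det-swap₀₁ : ∀ {m} (M : Mat (suc (suc m))) → det (M ∘ swap₀₁) ≈ - det M
  det-swap₀₁ M = begin
    det (M ∘ swap₀₁)                                     ≈⟨ det-pairs (M ∘ swap₀₁) ⟩
    sum (λ a → sum (λ b → pairTerm (M ∘ swap₀₁) a b))    ≈⟨ ∑-cong (λ a → ∑-cong (pairTerm-swap₀₁ M a)) ⟩
    sum (λ a → sum (λ b → - pairTerm M b a))             ≈⟨ ∑-cong (λ a → ∑-neg (λ b → pairTerm M b a)) ⟩
    sum (λ a → - sum (λ b → pairTerm M b a))             ≈⟨ ∑-neg (λ a → sum (λ b → pairTerm M b a)) ⟩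
    - sum (λ a → sum (λ b → pairTerm M b a))             ≈⟨ -‿cong (∑-comm (λ a b → pairTerm M b a)) ⟩
    - sum (λ b → sum (λ a → pairTerm M b a))             ≈⟨ -‿cong (sym (det-pairs M)) ⟩
    - det M                                              ∎

  self-negative : CharNotTwo → ∀ x → x ≈ - x → x ≈ 0#
  self-negative 2≉0 x x≈-x = cancelˡ (1# + 1#) x 2≉0 (begin
    (1# + 1#) * x ≈⟨ trans (distribʳ x 1# 1#) (+-cong (*-identityˡ x) (*-identityˡ x)) ⟩
    x + x         ≈⟨ +-congˡ x≈-x ⟩
    x + - x       ≈⟨ -‿inverseʳ x ⟩
    0#            ∎)

  det-minors-vanish : ∀ {m} (M : Mat (suc m)) → (∀ j → det (minor₀ M j) ≈ 0#) → det M ≈ 0#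
  det-minors-vanish M minors≈0 = ∑-zero (expansionTerm M) (λ j → trans (*-congˡ (minors≈0 j)) (zeroʳ _))

  -- a matrix whose first row reappears as row s+1 is singular.  For s = 0 this
  -- is det-swap₀₁; otherwise swapping rows 0 and 1 makes every first-row minor
  -- repeat its own first row as row s.
  det-repeated-row : CharNotTwo → ∀ {m} (M : Mat (suc m)) (s : Fin m) → (∀ t → M fzero t ≈ M (fsuc s) t) → det M ≈ 0#
  det-repeated-row 2≉0 {suc m} M fzero same = self-negative 2≉0 (det M) (begin
    det M            ≈⟨ det-cong M (M ∘ swap₀₁) rows ⟩
    det (M ∘ swap₀₁) ≈⟨ det-swap₀₁ M ⟩
    - det M          ∎)
    where
    rows : ∀ p t → M p t ≈ M (swap₀₁ p) t
    rows fzero           t = same t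
    rows (fsuc fzero)    t = sym (same t)
    rows (fsuc (fsuc p)) t = refl
  det-repeated-row 2≉0 {suc m} M (fsuc s) same = -≈0⇒≈0 (det M) (begin
    - det M          ≈⟨ sym (det-swap₀₁ M) ⟩
    det (M ∘ swap₀₁) ≈⟨ det-minors-vanish (M ∘ swap₀₁) (λ j →
                          det-repeated-row 2≉0 (minor₀ (M ∘ swap₀₁) j) s (λ t → same (punchIn j t))) ⟩
    0#               ∎)

  copyRow₀ : ∀ {m} → Mat (suc m) → Fin m → Mat (suc m)
  copyRow₀ N s p t with p Fin.≟ fsuc s
  ... | yes _ = N fzero t
  ... | no _  = N p t

  copyRow₀-at : ∀ {m} (N : Mat (suc m)) s t → copyRow₀ N s (fsuc s) t ≈ N fzero t
  copyRow₀-at N s t with fsuc s Fin.≟ fsuc s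
  ... | yes _ = refl
  ... | no s≢s = ⊥-elim (s≢s ≡.refl)

  copyRow₀-off : ∀ {m} (N : Mat (suc m)) s p → p ≢ fsuc s → ∀ t → copyRow₀ N s p t ≈ N p t
  copyRow₀-off N s p p≢ t with p Fin.≟ fsuc s
  ... | yes p≡ = ⊥-elim (p≢ p≡)
  ... | no _   = refl

  det-add-row : CharNotTwo → ∀ {m} (s : Fin m) α β (N P : Mat (suc m)) →
    (∀ p → p ≢ fsuc s → ∀ t → P p t ≈ N p t) →
    (∀ t → P (fsuc s) t ≈ α * N (fsuc s) t + β * N fzero t) → det P ≈ α * det N
  det-add-row 2≉0 s α β N P off at = begin
    det P
      ≈⟨ det-linear (fsuc s) α β N N′ P off (λ p p≢ t → trans (off p p≢ t) (sym (copyRow₀-off N s p p≢ t)))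
                    (λ t → trans (at t) (+-congˡ (*-congˡ (sym (copyRow₀-at N s t))))) ⟩
    α * det N + β * det N′
      ≈⟨ +-congˡ (*-congˡ (det-repeated-row 2≉0 N′ s (λ t → trans (copyRow₀-off N s fzero (λ ()) t)
                                                             (sym (copyRow₀-at N s t))))) ⟩
    α * det N + β * 0#
      ≈⟨ trans (+-congˡ (zeroʳ β)) (+-identityʳ _) ⟩
    α * det N ∎
    where N′ = copyRow₀ N s

  eliminate : ∀ {m} → Carrier → (Fin m → Carrier) → Mat (suc m) → ℕ → Mat (suc m)
  eliminate α β N k fzero    t = N fzero t
  eliminate α β N k (fsuc s) t with toℕ s ℕ.<? k
  ... | yes _ = α * N (fsuc s) t + β s * N fzero t
  ... | no _  = N (fsuc s) t

  eliminate-done : ∀ {m} α β (N : Mat (suc m)) k s → toℕ s < k →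
    ∀ t → eliminate α β N k (fsuc s) t ≈ α * N (fsuc s) t + β s * N fzero t
  eliminate-done α β N k s s<k t with toℕ s ℕ.<? k
  ... | yes _   = refl
  ... | no s≮k  = ⊥-elim (s≮k s<k)

  eliminate-pending : ∀ {m} α β (N : Mat (suc m)) k s → k ≤ toℕ s →
    ∀ t → eliminate α β N k (fsuc s) t ≈ N (fsuc s) t
  eliminate-pending α β N k s k≤s t with toℕ s ℕ.<? k
  ... | yes s<k = ⊥-elim (ℕP.<⇒≱ s<k k≤s)
  ... | no _    = refl

  det-eliminate : CharNotTwo → ∀ {m} α β (N : Mat (suc m)) k → k ≤ m → det (eliminate α β N k) ≈ α ^ k * det N
  det-eliminate 2≉0 α β N zero _ =
    trans (det-cong (eliminate α β N 0) N unchanged) (sym (*-identityˡ (det N)))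
    where
    unchanged : ∀ p t → eliminate α β N 0 p t ≈ N p t
    unchanged fzero    t = refl
    unchanged (fsuc s) t = eliminate-pending α β N 0 s ℕ.z≤n t
  det-eliminate 2≉0 α β N (suc k) k<m = begin
    det (eliminate α β N (suc k)) ≈⟨ det-add-row 2≉0 s α (β s) (eliminate α β N k) _ off at ⟩
    α * det (eliminate α β N k)   ≈⟨ *-congˡ (det-eliminate 2≉0 α β N k (ℕP.<⇒≤ k<m)) ⟩
    α * (α ^ k * det N)           ≈⟨ sym (*-assoc α _ _) ⟩
    α ^ suc k * det N             ∎
    where
    s = Fin.fromℕ< k<m
    s≡k : toℕ s ≡ k
    s≡k = FinP.toℕ-fromℕ< k<m
    off : ∀ p → p ≢ fsuc s → ∀ t → eliminate α β N (suc k) p t ≈ eliminate α β N k p t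
    off fzero    _   t = refl
    off (fsuc q) q≢s t with toℕ q ℕ.<? suc k | toℕ q ℕ.<? k
    ... | yes _   | yes _   = refl
    ... | no _    | no _    = refl
    ... | yes q<1+k | no q≮k =
      ⊥-elim (q≢s (≡.cong fsuc (FinP.toℕ-injective
                (≡.trans (ℕP.≤-antisym (ℕP.≤-pred q<1+k) (ℕP.≮⇒≥ q≮k)) (≡.sym s≡k)))))
    ... | no q≮1+k | yes q<k = ⊥-elim (q≮1+k (ℕP.m<n⇒m<1+n q<k))
    at : ∀ t → eliminate α β N (suc k) (fsuc s) t
             ≈ α * eliminate α β N k (fsuc s) t + β s * eliminate α β N k fzero t
    at t = trans (eliminate-done α β N (suc k) s (ℕP.≤-reflexive (≡.cong suc s≡k)) t)
                 (+-congʳ (*-congˡ (sym (eliminate-pending α β N k s (ℕP.≤-reflexive (≡.sym s≡k)) t))))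

  det-zero-column : ∀ {m} (M : Mat (suc m)) → (∀ p → M p fzero ≈ 0#) → det M ≈ 0#
  later-terms-vanish : ∀ {m} (M : Mat (suc m)) → (∀ p → M (fsuc p) fzero ≈ 0#) →
    sum (λ j → expansionTerm M (fsuc j)) ≈ 0#

  det-zero-column M zero-column = begin
    expansionTerm M fzero + sum (λ j → expansionTerm M (fsuc j))
      ≈⟨ +-cong (trans (*-congʳ (trans (*-congˡ (zero-column fzero)) (zeroʳ _))) (zeroˡ _))
                (later-terms-vanish M (zero-column ∘ fsuc)) ⟩
    0# + 0#
      ≈⟨ +-identityʳ 0# ⟩
    0# ∎

  later-terms-vanish {zero}  M below≈0 = refl
  later-terms-vanish {suc m} M below≈0 = ∑-zero (λ j → expansionTerm M (fsuc j)) λ j →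
    trans (*-congˡ (det-zero-column (minor₀ M (fsuc j)) below≈0)) (zeroʳ _)

  det-pivot : ∀ {m} (M : Mat (suc m)) → (∀ p → M (fsuc p) fzero ≈ 0#) →
    det M ≈ M fzero fzero * det (minor₀ M fzero)
  det-pivot M below≈0 = begin
    expansionTerm M fzero + sum (λ j → expansionTerm M (fsuc j)) ≈⟨ +-congˡ (later-terms-vanish M below≈0) ⟩
    expansionTerm M fzero + 0#                                   ≈⟨ +-identityʳ _ ⟩
    (1# * M fzero fzero) * det (minor₀ M fzero)                  ≈⟨ *-congʳ (*-identityˡ _) ⟩
    M fzero fzero * det (minor₀ M fzero)                         ∎

  -- the Schur complement of the pivot M₀₀, scaled by M₀₀ to stay division-free:
  -- entries M₀₀ M_{s+1,t+1} − M_{s+1,0} M_{0,t+1}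
  schur : ∀ {m} → Mat (suc m) → Mat m
  schur M s t = M fzero fzero * M (fsuc s) (fsuc t) + (- M (fsuc s) fzero) * M fzero (fsuc t)

  det-schur : CharNotTwo → ∀ {m} (M : Mat (suc m)) → M fzero fzero ^ m * det M ≈ M fzero fzero * det (schur M)
  det-schur 2≉0 {m} M = begin
    α ^ m * det M         ≈⟨ sym (det-eliminate 2≉0 α β M m ℕP.≤-refl) ⟩
    det E                 ≈⟨ det-pivot E column-cleared ⟩
    α * det (minor₀ E fzero) ≈⟨ *-congˡ (det-cong (minor₀ E fzero) (schur M) (λ s t →
                                 eliminate-done α β M m s (FinP.toℕ<n s) (fsuc t))) ⟩
    α * det (schur M)     ∎
    where
    α = M fzero fzero
    β = λ s → - M (fsuc s) fzero
    E = eliminate α β M m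
    column-cleared : ∀ p → E (fsuc p) fzero ≈ 0#
    column-cleared p = trans (eliminate-done α β M m p (FinP.toℕ<n p) fzero)
      (solve 2 (λ a b → (a :* b) :+ ((:- b) :* a) := con (+ 0)) refl α (M (fsuc p) fzero))

module CauchyMatrix {c ℓ} (F : Field c ℓ) where
  open Field F
  open FieldDefs F using (det)
  open FieldArithmetic F
  open Determinant F using (Mat; schur; det-schur)
  open IntegerCoefficientSolver commutativeRing using (solve; _:+_; _:*_; :-_; _:-_; _:=_)
  open import Relation.Binary.Reasoning.Setoid setoid

  -- M is the Cauchy matrix 1/(x_s − y_t) up to nonzero row and column factors,
  --   M_st · A_s · (x_s − y_t) · B_t = R_s · K_t,
  -- with distinct row nodes x, distinct column nodes y, and x_s ≠ y_t.
  -- (The factors A, B are what Gaussian elimination produces; R, K are the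
  -- numerators.)
  record CauchyLike {p q} (M : Fin p → Fin q → Carrier) : Set (c ⊔ ℓ) where
    field
      x A R : Fin p → Carrier
      y B K : Fin q → Carrier
      x-distinct    : ∀ s s′ → s ≢ s′ → ¬ (x s ≈ x s′)
      y-distinct    : ∀ t t′ → t ≢ t′ → ¬ (y t ≈ y t′)
      x≉y           : ∀ s t → ¬ (x s ≈ y t)
      A≉0           : ∀ s → ¬ (A s ≈ 0#)
      R≉0           : ∀ s → ¬ (R s ≈ 0#)
      B≉0           : ∀ t → ¬ (B t ≈ 0#)
      K≉0           : ∀ t → ¬ (K t ≈ 0#)
      factorisation : ∀ s t → ((M s t * A s) * (x s - y t)) * B t ≈ R s * K t

  restrict : ∀ {p q m m′} {M : Fin p → Fin q → Carrier} {f : Fin m → Fin p} {g : Fin m′ → Fin q} →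
    Injective _≡_ _≡_ f → Injective _≡_ _≡_ g → CauchyLike M → CauchyLike (λ s t → M (f s) (g t))
  restrict {f = f} {g} f-inj g-inj C = record
    { x = x ∘ f ; A = A ∘ f ; R = R ∘ f
    ; y = y ∘ g ; B = B ∘ g ; K = K ∘ g
    ; x-distinct    = λ s s′ s≢s′ → x-distinct (f s) (f s′) (s≢s′ ∘ f-inj)
    ; y-distinct    = λ t t′ t≢t′ → y-distinct (g t) (g t′) (t≢t′ ∘ g-inj)
    ; x≉y           = λ s t → x≉y (f s) (g t)
    ; A≉0 = A≉0 ∘ f ; R≉0 = R≉0 ∘ f ; B≉0 = B≉0 ∘ g ; K≉0 = K≉0 ∘ g
    ; factorisation = λ s t → factorisation (f s) (g t)
    }
    where open CauchyLike C

  pivot-nonzero : ∀ {m} {M : Mat (suc m)} → CauchyLike M → ¬ (M fzero fzero ≈ 0#)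
  pivot-nonzero {M = M} C M₀₀≈0 = *-nonzero (R fzero) (K fzero) (R≉0 fzero) (K≉0 fzero) (begin
    R fzero * K fzero                                             ≈⟨ sym (factorisation fzero fzero) ⟩
    ((M fzero fzero * A fzero) * (x fzero - y fzero)) * B fzero   ≈⟨ *-congʳ (*-congʳ (*-congʳ M₀₀≈0)) ⟩
    ((0# * A fzero) * (x fzero - y fzero)) * B fzero              ≈⟨ *-congʳ (*-congʳ (zeroˡ _)) ⟩
    (0# * (x fzero - y fzero)) * B fzero                          ≈⟨ *-congʳ (zeroˡ _) ⟩
    0# * B fzero                                                  ≈⟨ zeroˡ _ ⟩
    0#                                                            ∎)
    where open CauchyLike C

  -- The algebra behind Cauchy's determinant: with entries satisfying the
  -- factorisation at (0,0), (s,t), (s,0), (0,t), the Schur complement entry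
  -- M₀₀ M_st − M_s0 M_0t satisfies it with the updated factors of schur-cauchyLike.
  schur-entry : ∀ M₀₀ Mₛₜ Mₛ₀ M₀ₜ Aₛ A₀ B₀ Bₜ xₛ x₀ yₜ y₀ R₀ Rₛ K₀ Kₜ →
    ((M₀₀ * A₀) * (x₀ - y₀)) * B₀ ≈ R₀ * K₀ →
    ((Mₛₜ * Aₛ) * (xₛ - yₜ)) * Bₜ ≈ Rₛ * Kₜ →
    ((Mₛ₀ * Aₛ) * (xₛ - y₀)) * B₀ ≈ Rₛ * K₀ →
    ((M₀ₜ * A₀) * (x₀ - yₜ)) * Bₜ ≈ R₀ * Kₜ →
    (((M₀₀ * Mₛₜ + (- Mₛ₀) * M₀ₜ) * (Aₛ * (xₛ - y₀))) * (xₛ - yₜ)) * (((A₀ * (x₀ - yₜ)) * (x₀ - y₀)) * (B₀ * Bₜ))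
      ≈ (((R₀ * Rₛ) * K₀) * (x₀ - xₛ)) * (Kₜ * (yₜ - y₀))
  schur-entry M₀₀ Mₛₜ Mₛ₀ M₀ₜ Aₛ A₀ B₀ Bₜ xₛ x₀ yₜ y₀ R₀ Rₛ K₀ Kₜ f₀₀ fₛₜ fₛ₀ f₀ₜ = begin
    (((M₀₀ * Mₛₜ + (- Mₛ₀) * M₀ₜ) * (Aₛ * (xₛ - y₀))) * (xₛ - yₜ)) * (((A₀ * (x₀ - yₜ)) * (x₀ - y₀)) * (B₀ * Bₜ))
      ≈⟨ solve 12 (λ M₀₀ Mₛₜ Mₛ₀ M₀ₜ Aₛ A₀ B₀ Bₜ xₛ x₀ yₜ y₀ →
             (((M₀₀ :* Mₛₜ :+ (:- Mₛ₀) :* M₀ₜ) :* (Aₛ :* (xₛ :- y₀))) :* (xₛ :- yₜ))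
               :* (((A₀ :* (x₀ :- yₜ)) :* (x₀ :- y₀)) :* (B₀ :* Bₜ))
             := ((((M₀₀ :* A₀) :* (x₀ :- y₀)) :* B₀) :* (((Mₛₜ :* Aₛ) :* (xₛ :- yₜ)) :* Bₜ)) :* ((xₛ :- y₀) :* (x₀ :- yₜ))
                :- ((((Mₛ₀ :* Aₛ) :* (xₛ :- y₀)) :* B₀) :* (((M₀ₜ :* A₀) :* (x₀ :- yₜ)) :* Bₜ)) :* ((x₀ :- y₀) :* (xₛ :- yₜ)))
           refl M₀₀ Mₛₜ Mₛ₀ M₀ₜ Aₛ A₀ B₀ Bₜ xₛ x₀ yₜ y₀ ⟩
    ((((M₀₀ * A₀) * (x₀ - y₀)) * B₀) * (((Mₛₜ * Aₛ) * (xₛ - yₜ)) * Bₜ)) * ((xₛ - y₀) * (x₀ - yₜ))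
      - ((((Mₛ₀ * Aₛ) * (xₛ - y₀)) * B₀) * (((M₀ₜ * A₀) * (x₀ - yₜ)) * Bₜ)) * ((x₀ - y₀) * (xₛ - yₜ))
      ≈⟨ +-cong (*-congʳ (*-cong f₀₀ fₛₜ)) (-‿cong (*-congʳ (*-cong fₛ₀ f₀ₜ))) ⟩
    ((R₀ * K₀) * (Rₛ * Kₜ)) * ((xₛ - y₀) * (x₀ - yₜ)) - ((Rₛ * K₀) * (R₀ * Kₜ)) * ((x₀ - y₀) * (xₛ - yₜ))
      ≈⟨ solve 8 (λ R₀ Rₛ K₀ Kₜ xₛ x₀ yₜ y₀ →
             ((R₀ :* K₀) :* (Rₛ :* Kₜ)) :* ((xₛ :- y₀) :* (x₀ :- yₜ))
               :- ((Rₛ :* K₀) :* (R₀ :* Kₜ)) :* ((x₀ :- y₀) :* (xₛ :- yₜ))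
             := (((R₀ :* Rₛ) :* K₀) :* (x₀ :- xₛ)) :* (Kₜ :* (yₜ :- y₀)))
           refl R₀ Rₛ K₀ Kₜ xₛ x₀ yₜ y₀ ⟩
    (((R₀ * Rₛ) * K₀) * (x₀ - xₛ)) * (Kₜ * (yₜ - y₀)) ∎

  schur-cauchyLike : ∀ {m} {M : Mat (suc m)} → CauchyLike M → CauchyLike (schur M)
  schur-cauchyLike {M = M} C = record
    { x = x ∘ fsuc
    ; A = λ s → A (fsuc s) * (x (fsuc s) - y fzero)
    ; R = λ s → ((R fzero * R (fsuc s)) * K fzero) * (x fzero - x (fsuc s))
    ; y = y ∘ fsuc
    ; B = λ t → ((A fzero * (x fzero - y (fsuc t))) * (x fzero - y fzero)) * (B fzero * B (fsuc t))
    ; K = λ t → K (fsuc t) * (y (fsuc t) - y fzero)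
    ; x-distinct = λ s s′ s≢s′ → x-distinct (fsuc s) (fsuc s′) (s≢s′ ∘ FinP.suc-injective)
    ; y-distinct = λ t t′ t≢t′ → y-distinct (fsuc t) (fsuc t′) (t≢t′ ∘ FinP.suc-injective)
    ; x≉y = λ s t → x≉y (fsuc s) (fsuc t)
    ; A≉0 = λ s → *-nonzero _ _ (A≉0 (fsuc s)) (difference (x≉y (fsuc s) fzero))
    ; R≉0 = λ s → *-nonzero _ _ (*-nonzero _ _ (*-nonzero _ _ (R≉0 fzero) (R≉0 (fsuc s))) (K≉0 fzero))
                    (difference (x-distinct fzero (fsuc s) (λ ())))
    ; B≉0 = λ t → *-nonzero _ _
                    (*-nonzero _ _ (*-nonzero _ _ (A≉0 fzero) (difference (x≉y fzero (fsuc t))))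
                                   (difference (x≉y fzero fzero)))
                    (*-nonzero _ _ (B≉0 fzero) (B≉0 (fsuc t)))
    ; K≉0 = λ t → *-nonzero _ _ (K≉0 (fsuc t)) (difference (y-distinct (fsuc t) fzero (λ ())))
    ; factorisation = λ s t → schur-entry
        (M fzero fzero) (M (fsuc s) (fsuc t)) (M (fsuc s) fzero) (M fzero (fsuc t))
        (A (fsuc s)) (A fzero) (B fzero) (B (fsuc t)) (x (fsuc s)) (x fzero) (y (fsuc t)) (y fzero)
        (R fzero) (R (fsuc s)) (K fzero) (K (fsuc t))
        (factorisation fzero fzero) (factorisation (fsuc s) (fsuc t))
        (factorisation (fsuc s) fzero) (factorisation fzero (fsuc t))
    }
    where
    open CauchyLike C
    difference : ∀ {a b} → ¬ (a ≈ b) → ¬ (a - b ≈ 0#)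
    difference = sub-nonzero _ _

  -- Cauchy: a square rescaled Cauchy matrix is nonsingular (induction on the
  -- size, since det-schur relates det M to the determinant of its Schur complement)
  cauchyLike-nonsingular : CharNotTwo → ∀ {m} (M : Mat m) → CauchyLike M → ¬ (det M ≈ 0#)
  cauchyLike-nonsingular 2≉0 {zero}  M C = 1≉0
  cauchyLike-nonsingular 2≉0 {suc m} M C det≈0 =
    cauchyLike-nonsingular 2≉0 (schur M) (schur-cauchyLike C)
      (cancelˡ (M fzero fzero) (det (schur M)) (pivot-nonzero C)
        (trans (sym (det-schur 2≉0 M)) (trans (*-congˡ det≈0) (zeroʳ _))))

module IndexProducts {c ℓ} (F : Field c ℓ) where
  open Field F
  open FieldDefs F using (∏; ∏pairs; I; I∖)
  open FieldArithmetic F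
  open import Algebra.Properties.CommutativeSemigroup *-commutativeSemigroup using (x∙yz≈y∙xz)
  open import Data.List.Membership.Propositional using (_∈_)
  open import Data.List.Membership.Propositional.Properties using (∈-map⁺; ∈-upTo⁺)
  open import Data.List.Relation.Unary.Any using (here; there)
  open import Data.List.Relation.Unary.Unique.Propositional using (Unique)
  open import Data.List.Relation.Unary.AllPairs using (_∷_)
  import Data.List.Relation.Unary.Unique.Propositional.Properties as UniqueP
  open import Relation.Binary.Reasoning.Setoid setoid

  without : ℕ → List ℕ → List ℕ
  without j = filter (λ l → ¬? (l ℕ.≟ j))

  ∏-nonzero : ∀ xs (f : ℕ → Carrier) → All (λ l → ¬ (f l ≈ 0#)) xs → ¬ (∏ xs f ≈ 0#)
  ∏-nonzero []       f []             = 1≉0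
  ∏-nonzero (l ∷ xs) f (fl≉0 ∷ rest) = *-nonzero _ _ fl≉0 (∏-nonzero xs f rest)

  ∏-extract : ∀ {xs j} (f : ℕ → Carrier) → Unique xs → j ∈ xs → ∏ xs f ≈ f j * ∏ (without j xs) f
  ∏-extract {x ∷ xs} f (x∉xs ∷ _) (here ≡.refl) =
    *-congˡ (reflexive (≡.cong (λ ys → ∏ ys f) (≡.sym only-x-removed)))
    where
    only-x-removed : without x (x ∷ xs) ≡ xs
    only-x-removed = ≡.trans (ListP.filter-reject (λ l → ¬? (l ℕ.≟ x)) (λ x≢x → x≢x ≡.refl))
                     (ListP.filter-all (λ l → ¬? (l ℕ.≟ x)) (All.map (λ x≢l l≡x → x≢l (≡.sym l≡x)) x∉xs))
  ∏-extract {x ∷ xs} {j} f (x∉xs ∷ unique) (there j∈xs) = begin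
    f x * ∏ xs f                     ≈⟨ *-congˡ (∏-extract f unique j∈xs) ⟩
    f x * (f j * ∏ (without j xs) f) ≈⟨ x∙yz≈y∙xz (f x) (f j) _ ⟩
    f j * (f x * ∏ (without j xs) f) ≡⟨ ≡.cong (λ ys → f j * ∏ ys f)
                                          (≡.sym (ListP.filter-accept (λ l → ¬? (l ℕ.≟ j)) (All.lookup x∉xs j∈xs))) ⟩
    f j * ∏ (without j (x ∷ xs)) f   ∎

  All-I : ∀ {P : ℕ → Set ℓ} r → (∀ {k} → k < r → P (suc k)) → All P (I r)
  All-I r P-suc = AllP.map⁺ (AllP.applyUpTo⁺₁ (λ k → k) r P-suc)

  ∏-I-split : ∀ r k (f : ℕ → Carrier) → k < r → ∏ (I r) f ≈ f (suc k) * ∏ (I∖ r (suc k)) f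
  ∏-I-split r k f k<r =
    ∏-extract f (UniqueP.map⁺ ℕP.suc-injective (UniqueP.upTo⁺ r)) (∈-map⁺ suc (∈-upTo⁺ k<r))

  PairsNonzero : List ℕ → (ℕ → ℕ → Carrier) → Set ℓ
  PairsNonzero S g = All (λ l → All (λ e → e < l → ¬ (g l e ≈ 0#)) S) S

  ∏pairs-nonzero : ∀ S g → PairsNonzero S g → ¬ (∏pairs S g ≈ 0#)
  ∏pairs-nonzero S g pairs = ∏-nonzero S _ (All.map (λ {l} row →
    ∏-nonzero (filter (λ e → e ℕ.<? l) S) (g l)
      (All.zipWith (λ (e<l , g≉0) → g≉0 e<l)
                   (AllP.all-filter (λ e → e ℕ.<? l) S , AllP.filter⁺ (λ e → e ℕ.<? l) row))) pairs)

  PairsNonzero-without : ∀ S g j → PairsNonzero S g → PairsNonzero (without j S) g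
  PairsNonzero-without S g j pairs =
    AllP.filter⁺ (λ l → ¬? (l ℕ.≟ j)) (All.map (AllP.filter⁺ (λ l → ¬? (l ℕ.≟ j))) pairs)

module Selection {c ℓ} (F : Field c ℓ) where
  open Field F using (_≈_; 0#)
  open FieldDefs F using (StrictInc; minor; HasRank)

  strictInc-injective : ∀ {m p} {f : Fin m → Fin p} → StrictInc f → Injective _≡_ _≡_ f
  strictInc-injective {f = f} f-inc {s} {s′} fs≡fs′ with FinP.<-cmp s s′
  ... | tri< s<s′ _ _ = ⊥-elim (ℕP.<-irrefl (≡.cong toℕ fs≡fs′) (f-inc s s′ s<s′))
  ... | tri≈ _ s≡s′ _ = s≡s′
  ... | tri> _ _ s′<s = ⊥-elim (ℕP.<-irrefl (≡.cong toℕ (≡.sym fs≡fs′)) (f-inc s′ s s′<s))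

  strictInc⇒≤ : ∀ {m p} {f : Fin m → Fin p} → StrictInc f → m ≤ p
  strictInc⇒≤ f-inc = FinP.injective⇒≤ (strictInc-injective f-inc)

  inject≤-strictInc : ∀ {m p} (m≤p : m ≤ p) → StrictInc (λ (i : Fin m) → Fin.inject≤ i m≤p)
  inject≤-strictInc m≤p i j i<j =
    ≡.subst₂ _<_ (≡.sym (FinP.toℕ-inject≤ i m≤p)) (≡.sym (FinP.toℕ-inject≤ j m≤p)) i<j

  -- if every square submatrix is nonsingular, the rank is the smaller dimension:
  -- the leading k×k minor is nonzero, and there are no larger square submatrices
  rank-of-nonsingular : ∀ {p q} (M : Fin p → Fin q → Field.Carrier F) →
    (∀ {m} (f : Fin m → Fin p) (g : Fin m → Fin q) → StrictInc f → StrictInc g → ¬ (minor M f g ≈ 0#)) →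
    HasRank M (p ⊓ q)
  rank-of-nonsingular {p} {q} M nonsingular =
    (first-rows , first-cols , inject≤-strictInc rows≤ , inject≤-strictInc cols≤ ,
     nonsingular first-rows first-cols (inject≤-strictInc rows≤) (inject≤-strictInc cols≤))
    , λ f g f-inc g-inc → ⊥-elim (ℕP.n≮n (p ⊓ q) (ℕP.⊓-glb (strictInc⇒≤ f-inc) (strictInc⇒≤ g-inc)))
    where
    rows≤ = ℕP.m⊓n≤m p q
    cols≤ = ℕP.m⊓n≤n p q
    first-rows = λ (i : Fin (p ⊓ q)) → Fin.inject≤ i rows≤
    first-cols = λ (i : Fin (p ⊓ q)) → Fin.inject≤ i cols≤


module MatrixC {c ℓ} (F : Field c ℓ) (a : ℕ → Field.Carrier F)
    (a≉0 : ∀ l → ¬ Field._≈_ F (a (suc l)) (Field.0# F))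
    (a-distinct : ∀ l e → l ≢ e → ¬ Field._≈_ F (a (suc l)) (a (suc e)))
    (n r : ℕ) where
  open Field F
  open FieldDefs F using (C; ∏; ∏pairs; I; I∖; d; sgn)
  open FieldArithmetic F
  open IndexProducts F
  open FieldDefs F using (StrictInc; minor)
  open CauchyMatrix F using (CauchyLike; restrict; cauchyLike-nonsingular)
  open Selection F using (strictInc-injective)
  open IntegerCoefficientSolver commutativeRing using (solve; _:*_; _:-_; _:=_; con)
  open import Relation.Binary.Reasoning.Setoid setoid

  row-index : Fin (n ∸ r) → ℕ
  row-index p = suc r ℕ.+ toℕ p

  x : Fin (n ∸ r) → Carrier
  x p = a (row-index p)

  y : Fin (suc r) → Carrier
  y fzero    = 0#
  y (fsuc j) = a (suc (toℕ j))

  R : Fin (n ∸ r) → Carrier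
  R p = x p * ∏ (I r) (λ l → d a (row-index p) l)

  K : Fin (suc r) → Carrier
  K fzero    = sgn r * ∏pairs (I r) (d a)
  K (fsuc j) = sgn (r ℕ.+ suc (toℕ j)) * ∏pairs (I∖ r (suc (toℕ j))) (λ l e → a l * d a l e)

  -- C_{pj} · (x_p − y_j) = R_p · K_j; for j ≥ 1 the factor a_i − a_j completes
  -- the product over I_j to the product over I
  C-factorisation : ∀ p j → C a n r p j * (x p - y j) ≈ R p * K j
  C-factorisation p fzero =
    solve 4 (λ σ Π V ξ → ((σ :* Π) :* V) :* (ξ :- con (+ 0)) := (ξ :* Π) :* (σ :* V))
      refl (sgn r) (∏ (I r) (λ l → d a (row-index p) l)) (∏pairs (I r) (d a)) (x p)
  C-factorisation p (fsuc j) = begin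
    (((σ * aᵢ) * Πⱼ) * W) * (aᵢ - aⱼ) ≈⟨ solve 5 (λ σ aᵢ Πⱼ W D → (((σ :* aᵢ) :* Πⱼ) :* W) :* D
                                                 := (aᵢ :* (D :* Πⱼ)) :* (σ :* W))
                                         refl σ aᵢ Πⱼ W (aᵢ - aⱼ) ⟩
    (aᵢ * ((aᵢ - aⱼ) * Πⱼ)) * (σ * W) ≈⟨ *-congʳ (*-congˡ (sym (∏-I-split r (toℕ j) _ (FinP.toℕ<n j)))) ⟩
    R p * K (fsuc j)                  ∎
    where
    σ  = sgn (r ℕ.+ suc (toℕ j))
    aᵢ = x p
    aⱼ = a (suc (toℕ j))
    Πⱼ = ∏ (I∖ r (suc (toℕ j))) (λ l → d a (row-index p) l)
    W  = ∏pairs (I∖ r (suc (toℕ j))) (λ l e → a l * d a l e)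

  row-index≢ : ∀ m k → k < r → r ℕ.+ m ≢ k
  row-index≢ m k k<r r+m≡k = ℕP.<⇒≢ (ℕP.<-≤-trans k<r (ℕP.m≤m+n r m)) (≡.sym r+m≡k)

  differences≉0 : ∀ {k k′} → k′ < k → ¬ (d a (suc k) (suc k′) ≈ 0#)
  differences≉0 k′<k = sub-nonzero _ _ (a-distinct _ _ (λ k≡k′ → ℕP.<⇒≢ k′<k (≡.sym k≡k′)))

  R≉0 : ∀ p → ¬ (R p ≈ 0#)
  R≉0 p = *-nonzero _ _ (a≉0 (r ℕ.+ toℕ p)) (∏-nonzero (I r) _ (All-I r λ {k} k<r →
    sub-nonzero _ _ (a-distinct (r ℕ.+ toℕ p) k (row-index≢ (toℕ p) k k<r))))

  K≉0 : ∀ j → ¬ (K j ≈ 0#)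
  K≉0 fzero    = *-nonzero _ _ (sgn-nonzero r) (∏pairs-nonzero (I r) (d a)
    (All-I r λ _ → All-I r λ _ e<l → differences≉0 (ℕP.≤-pred e<l)))
  K≉0 (fsuc j) = *-nonzero _ _ (sgn-nonzero (r ℕ.+ suc (toℕ j))) (∏pairs-nonzero _ _
    (PairsNonzero-without (I r) _ (suc (toℕ j))
      (All-I r λ {k} _ → All-I r λ _ e<l → *-nonzero _ _ (a≉0 k) (differences≉0 (ℕP.≤-pred e<l)))))

  x-distinct : ∀ p p′ → p ≢ p′ → ¬ (x p ≈ x p′)
  x-distinct p p′ p≢p′ = a-distinct (r ℕ.+ toℕ p) (r ℕ.+ toℕ p′)
    (p≢p′ ∘ FinP.toℕ-injective ∘ ℕP.+-cancelˡ-≡ r _ _)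

  y-distinct : ∀ j j′ → j ≢ j′ → ¬ (y j ≈ y j′)
  y-distinct fzero    fzero     j≢j′ = ⊥-elim (j≢j′ ≡.refl)
  y-distinct fzero    (fsuc j′) _    = a≉0 (toℕ j′) ∘ sym
  y-distinct (fsuc j) fzero     _    = a≉0 (toℕ j)
  y-distinct (fsuc j) (fsuc j′) j≢j′ = a-distinct (toℕ j) (toℕ j′) (j≢j′ ∘ ≡.cong fsuc ∘ FinP.toℕ-injective)

  x≉y : ∀ p j → ¬ (x p ≈ y j)
  x≉y p fzero    = a≉0 (r ℕ.+ toℕ p)
  x≉y p (fsuc j) = a-distinct (r ℕ.+ toℕ p) (toℕ j) (row-index≢ (toℕ p) (toℕ j) (FinP.toℕ<n j))

  C-cauchyLike : CauchyLike (C a n r)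
  C-cauchyLike = record
    { x = x ; A = λ _ → 1# ; R = R
    ; y = y ; B = λ _ → 1# ; K = K
    ; x-distinct = x-distinct ; y-distinct = y-distinct ; x≉y = x≉y
    ; A≉0 = λ _ → 1≉0 ; R≉0 = R≉0 ; B≉0 = λ _ → 1≉0 ; K≉0 = K≉0
    ; factorisation = λ p j → trans (trans (*-identityʳ _) (*-congʳ (*-identityʳ _))) (C-factorisation p j)
    }

  C-minor≉0 : CharNotTwo → ∀ {m} (f : Fin m → Fin (n ∸ r)) (g : Fin m → Fin (suc r)) →
    StrictInc f → StrictInc g → ¬ (minor (C a n r) f g ≈ 0#)
  C-minor≉0 2≉0 f g f-inc g-inc = cauchyLike-nonsingular 2≉0 _
    (restrict (strictInc-injective f-inc) (strictInc-injective g-inc) C-cauchyLike)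
open Field using (Carrier; _≈_; 0#)
open FieldDefs using (CharZero; StrictInc; minor; C; HasRank)

proposition4p2 : ∀ {c ℓ} (F : Field c ℓ) →
    CharZero F →
    (a : ℕ → Carrier F) →
    (∀ l → ¬ (_≈_ F (a (suc l)) (0# F))) →
    (∀ l e → l ≢ e → ¬ (_≈_ F (a (suc l)) (a (suc e)))) →
    (r n : ℕ) → 2 ≤ r → r < n →
    ((m : ℕ) → m ≤ (suc r ⊓ (n ∸ r)) →
    (f : Fin m → Fin (n ∸ r)) (g : Fin m → Fin (suc r)) →
    StrictInc F f → StrictInc F g → ¬ (_≈_ F (minor F (C F a n r) f g) (0# F)))
    × HasRank F (C F a n r) ((n ∸ r) ⊓ suc r)
proposition4p2 F charZero a a≉0 a-distinct r n _ _ =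
  (λ _ _ → C-minor≉0 2≉0) , rank-of-nonsingular (C F a n r) (C-minor≉0 2≉0)
  where
  open FieldArithmetic F using (CharNotTwo; charZero⇒charNotTwo)
  open MatrixC F a a≉0 a-distinct n r using (C-minor≉0)
  open Selection F using (rank-of-nonsingular)

  2≉0 : CharNotTwo
  2≉0 = charZero⇒charNotTwo charZero
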